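{- Let $D$ be a digraph. Then for every $v\in V(D)$ there exist a set $S\subseteq V(D)$ with $|S|\le c(D)$ and a partition $(A,B)$ of $V(D)\setminus S$ such that $N_D^+(v)\subseteq A\cup S$, $N_D^-(v)\subseteq B\cup S$, and there is no arc of $D$ starting in $A$ and ending in $B$.
   Context: Digraphs are finite, have no loops and no parallel arcs (antiparallel arcs allowed). $N_D^+(v),N_D^-(v)$ denote the out- and in-neighbourhood of $v$. A collection of openly disjoint directed cycles through a vertex is a collection of directed cycles $C_1,\ldots,C_k$ in $D$ such that some vertex $v$ lies on all of them and the sets $V(C_1)\setminus\{v\},\ldots,V(C_k)\setminus\{v\}$ are pairwise disjoint. $c(D)$ denotes the maximum size of such a collection in $D$. Parts of the partition $(A,B)$ may be empty. -}

module Defs where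

open import Data.Nat using (ℕ; _≤_)
open import Data.Fin using (Fin)
open import Data.Bool using (Bool; true; false)
open import Data.List using (List; []; _∷_; length)
open import Data.List.Relation.Unary.All using (All)
open import Data.List.Relation.Unary.AllPairs using (AllPairs)
open import Data.List.Relation.Unary.Unique.Propositional using (Unique)
open import Data.List.Relation.Binary.Disjoint.Propositional using (Disjoint)
open import Data.Product using (Σ; _×_; ∃-syntax)
open import Data.Sum using (_⊎_)
open import Relation.Binary.PropositionalEquality using (_≡_)

-- A digraph on vertex set Fin n: arc relation given by a Boolean adjacency
-- function (so no parallel arcs), without loops. Antiparallel arcs allowed.
record Digraph (n : ℕ) : Set where
  field
    adj      : Fin n → Fin n → Bool
    loopless : ∀ v → adj v v ≡ false

open Digraph public

Arc : ∀ {n} → Digraph n → Fin n → Fin n → Set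
Arc D u w = adj D u w ≡ true

-- ArcWalk D u xs w : u → x₁ → … → xₘ → w is a sequence of arcs of D
-- where xs = x₁ … xₘ.
data ArcWalk {n} (D : Digraph n) : Fin n → List (Fin n) → Fin n → Set where
  last : ∀ {u w} → Arc D u w → ArcWalk D u [] w
  step : ∀ {u x xs w} → Arc D u x → ArcWalk D x xs w → ArcWalk D u (x ∷ xs) w

-- A directed cycle through v, given by the list ws = w₁ … wₘ (m ≥ 1) of its
-- vertices other than v in cyclic order: v → w₁ → … → wₘ → v, with
-- v, w₁, …, wₘ pairwise distinct.
CycleThrough : ∀ {n} → Digraph n → Fin n → List (Fin n) → Set
CycleThrough D v ws = (1 ≤ length ws) × Unique (v ∷ ws) × ArcWalk D v ws v

OpenlyDisjointCycles : ∀ {n} → Digraph n → Fin n → List (List (Fin n)) → Set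
OpenlyDisjointCycles D v cs = All (CycleThrough D v) cs × AllPairs Disjoint cs

-- IsC D k : k = c(D), the maximum size of a collection of openly disjoint
-- directed cycles through a vertex (0 if there is none, e.g. no vertices).
IsC : ∀ {n} → Digraph n → ℕ → Set
IsC {n} D k =
  (k ≡ 0 ⊎ (∃[ v ] ∃[ cs ] (OpenlyDisjointCycles D v cs × length cs ≡ k)))
  × (∀ (v : Fin n) (cs : List (List (Fin n))) → OpenlyDisjointCycles D v cs → length cs ≤ k)

module Submission where

open import Defs
open import Data.Nat using (ℕ; _≤_)
open import Data.Fin using (Fin)
open import Data.Fin.Subset using (Subset; _∈_; _∉_; ∣_∣)
open import Data.Product using (_×_; ∃-syntax)
open import Data.Sum using (_⊎_)
open import Relation.Nullary using (¬_)

open import Data.Bool using (Bool; true)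
import Data.Bool as Bool
open import Data.Fin using (zero; suc)
open import Data.Fin.Properties using (suc-injective; 0≢1+n; _≟_)
open import Data.Fin.Subset using (inside; outside; _∪_; _∩_; ∁; ⁅_⁆; _-_)
open import Data.Fin.Subset.Properties
  using ( _∈?_; ∣p∣≤∣x∷p∣; ∣⁅x⁆∣≡1; x∈p⇒∣p-x∣<∣p∣; x∈p∧x≢y⇒x∈p-y; x∈⁅x⁆; x∈⁅y⁆⇒x≡y
        ; x∈p∪q⁺; x∈p∪q⁻; x∈p∩q⁺; x∈p∩q⁻; x∉p⇒x∈∁p; x∈∁p⇒x∉p )
open import Data.List using (List; []; _∷_; length; map; _++_; take; drop; filter; cartesianProduct; allFin)
open import Data.List.Properties using (length-map)
open import Data.List.Membership.Propositional using () renaming (_∈_ to _∈ₗ_)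
open import Data.List.Membership.Propositional.Properties
  using (∈-map⁻; ∈-++⁻; ∈-filter⁺; ∈-filter⁻; ∈-cartesianProduct⁺; ∈-allFin)
import Data.List.Membership.DecPropositional as DecMembership
open import Data.List.Relation.Binary.Disjoint.Propositional using (Disjoint)
open import Data.List.Relation.Binary.Disjoint.Propositional.Properties
  using () renaming (sym to Disjoint-sym)
open import Data.List.Relation.Binary.Subset.Propositional using () renaming (_⊆_ to _⊆ₗ_)
open import Data.List.Relation.Binary.Sublist.Propositional using (lookup)
open import Data.List.Relation.Binary.Sublist.Propositional.Properties using (take-⊆; drop-⊆)
open import Data.List.Relation.Unary.All as All using (All; []; _∷_)
import Data.List.Relation.Unary.All.Properties as All
open import Data.List.Relation.Unary.AllPairs as AllPairs using (AllPairs; []; _∷_)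
import Data.List.Relation.Unary.AllPairs.Properties as AllPairs
open import Data.List.Relation.Unary.Any using (here; there)
open import Data.List.Relation.Unary.Unique.Propositional using (Unique)
import Data.List.Relation.Unary.Unique.Propositional.Properties as Unique
open import Data.Nat using (suc; _+_; _<_; z≤n; s≤s; _≤?_)
open import Data.Nat.Properties
  using (≤-refl; ≤-trans; +-suc; +-comm; +-monoʳ-≤; n≮n; ≰⇒>; module ≤-Reasoning)
open import Data.Product using (∃; Σ-syntax; _,_; proj₁; proj₂)
open import Data.Sum using (inj₁; inj₂; [_,_]′)
open import Data.Vec using ([]; _∷_; here; there; tabulate)
open import Data.Vec.Properties using (lookup∘tabulate; lookup⇒[]=; []=⇒lookup)
open import Function using (_∘_; _on_; id)
open import Relation.Binary.Definitions using (Symmetric)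
open import Relation.Binary.PropositionalEquality using (_≡_; _≢_; refl; sym; trans; cong; subst; ≢-sym)
open import Relation.Nullary using (Dec; yes; no; ¬?; _×-dec_; contradiction)

-- Delete the arcs entering v.  Closed up through v, a path from N⁺(v) to N⁻(v) in the
-- remaining graph is a cycle through v, and vertex-disjoint paths give openly disjoint
-- cycles.  So by Menger's theorem some S with |S| ≤ c(D) separates N⁺(v) from N⁻(v): there
-- is a set A ⊇ N⁺(v) ∖ S, disjoint from N⁻(v), that no remaining arc leaves except into S.
-- The required partition is A ∪ {v} and the rest, both with S removed.
--
-- Menger's theorem is proved by induction on the list of arcs, producing together k
-- disjoint X–Y paths and a separation (S, A) with |S| ≤ k.  A new arc xy only matters if it
-- leads out of A ∪ S.  Then separate X from S+x, and S+y from Y, in the old graph; a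
-- separation of size ≤ k on either side repairs (S, A).  Otherwise both sides carry more
-- than k disjoint paths.  As |S+y| ≤ k+1, every vertex of S+y is the last exit from S+y of
-- one of the S+y–Y paths.  Cut each X–(S+x) path at its first visit to S+x and continue it
-- along the path leaving from where it stopped (through xy if it stopped at x): the cut
-- paths stay inside A ∪ S and the continuations outside, so this gives as many disjoint
-- X–Y paths as there were X–(S+x) paths, and S+x separates X from Y.

variable
  n k k₁ k₂ : ℕ

∣p∪q∣≤∣p∣+∣q∣ : (p q : Subset n) → ∣ p ∪ q ∣ ≤ ∣ p ∣ + ∣ q ∣
∣p∪q∣≤∣p∣+∣q∣ []            []            = z≤n
∣p∪q∣≤∣p∣+∣q∣ (outside ∷ p) (outside ∷ q) = ∣p∪q∣≤∣p∣+∣q∣ p q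
∣p∪q∣≤∣p∣+∣q∣ (outside ∷ p) (inside ∷ q)  =
  subst (suc ∣ p ∪ q ∣ ≤_) (sym (+-suc ∣ p ∣ ∣ q ∣)) (s≤s (∣p∪q∣≤∣p∣+∣q∣ p q))
∣p∪q∣≤∣p∣+∣q∣ (inside ∷ p)  (s ∷ q)       =
  s≤s (≤-trans (∣p∪q∣≤∣p∣+∣q∣ p q) (+-monoʳ-≤ ∣ p ∣ (∣p∣≤∣x∷p∣ s q)))

∣p∪⁅x⁆∣≤1+∣p∣ : (p : Subset n) (x : Fin n) → ∣ p ∪ ⁅ x ⁆ ∣ ≤ suc ∣ p ∣
∣p∪⁅x⁆∣≤1+∣p∣ p x = begin
  ∣ p ∪ ⁅ x ⁆ ∣     ≤⟨ ∣p∪q∣≤∣p∣+∣q∣ p ⁅ x ⁆ ⟩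
  ∣ p ∣ + ∣ ⁅ x ⁆ ∣ ≡⟨ cong (∣ p ∣ +_) (∣⁅x⁆∣≡1 x) ⟩
  ∣ p ∣ + 1         ≡⟨ +-comm ∣ p ∣ 1 ⟩
  suc ∣ p ∣         ∎
  where open ≤-Reasoning

x∈p∩∁q⁺ : {p q : Subset n} {x : Fin n} → x ∈ p → x ∉ q → x ∈ p ∩ ∁ q
x∈p∩∁q⁺ x∈p x∉q = x∈p∩q⁺ (x∈p , x∉p⇒x∈∁p x∉q)

x∈p∩∁q⁻ : (p q : Subset n) {x : Fin n} → x ∈ p ∩ ∁ q → x ∈ p × x ∉ q
x∈p∩∁q⁻ p q x∈ = let x∈p , x∈∁q = x∈p∩q⁻ p (∁ q) x∈ in x∈p , x∈∁p⇒x∉p x∈∁q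

there-∃ : ∀ s {p : Subset n} → ∃ (_∈ p) → ∃ (_∈ s ∷ p)
there-∃ _ (u , u∈p) = suc u , there u∈p

there-∃-distinct : ∀ s {p : Subset n} {us : List (∃ (_∈ p))} →
                   AllPairs (_≢_ on proj₁) us → AllPairs (_≢_ on proj₁) (map (there-∃ s) us)
there-∃-distinct _ distinct = AllPairs.map⁺ (AllPairs.map (_∘ suc-injective) distinct)

enumerate : (p : Subset n) → Σ[ us ∈ List (∃ (_∈ p)) ] AllPairs (_≢_ on proj₁) us × length us ≡ ∣ p ∣
enumerate []           = [] , [] , refl
enumerate (inside ∷ p) with enumerate p
... | us , distinct , length≡ =
  (zero , here) ∷ map (there-∃ inside) us
  , All.map⁺ (All.universal (λ _ → 0≢1+n) us) ∷ there-∃-distinct inside distinct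
  , cong suc (trans (length-map (there-∃ inside) us) length≡)
enumerate (outside ∷ p) with enumerate p
... | us , distinct , length≡ =
  map (there-∃ outside) us
  , there-∃-distinct outside distinct
  , trans (length-map (there-∃ outside) us) length≡

length≤∣p∣ : {p : Subset n} {xs : List (Fin n)} → Unique xs → All (_∈ p) xs → length xs ≤ ∣ p ∣
length≤∣p∣ []                [] = z≤n
length≤∣p∣ {p = p} {x ∷ xs} (x∉xs ∷ unique) (x∈p ∷ xs⊆p) = begin-strict
  length xs ≤⟨ length≤∣p∣ unique xs⊆p-x ⟩
  ∣ p - x ∣ <⟨ x∈p⇒∣p-x∣<∣p∣ x∈p ⟩
  ∣ p ∣     ∎
  where
  open ≤-Reasoning
  xs⊆p-x : All (_∈ p - x) xs
  xs⊆p-x = All.zipWith (λ (y∈p , x≢y) → x∈p∧x≢y⇒x∈p-y y∈p (≢-sym x≢y)) (xs⊆p , x∉xs)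

∣p∣≤length⇒∈ : {p : Subset n} {xs : List (Fin n)} → Unique xs → All (_∈ p) xs →
               ∣ p ∣ ≤ length xs → ∀ {z} → z ∈ p → z ∈ₗ xs
∣p∣≤length⇒∈ {xs = xs} unique xs⊆p ∣p∣≤ {z} z∈p with DecMembership._∈?_ _≟_ z xs
... | yes z∈xs = z∈xs
... | no  z∉xs = contradiction (≤-trans (length≤∣p∣ (z≢xs ∷ unique) (z∈p ∷ xs⊆p)) ∣p∣≤) (n≮n (length xs))
  where
  z≢xs : All (z ≢_) xs
  z≢xs = All.tabulate λ { w∈xs refl → z∉xs w∈xs }

Disjoint-resp-⊇ : ∀ {A : Set} {xs xs′ ys ys′ : List A} →
                  xs′ ⊆ₗ xs → ys′ ⊆ₗ ys → Disjoint xs ys → Disjoint xs′ ys′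
Disjoint-resp-⊇ xs′⊆xs ys′⊆ys xs#ys (u∈xs′ , u∈ys′) = xs#ys (xs′⊆xs u∈xs′ , ys′⊆ys u∈ys′)

AllPairs-lookup : ∀ {A : Set} {R : A → A → Set} {xs : List A} {x y : A} →
                  Symmetric R → AllPairs R xs → x ∈ₗ xs → y ∈ₗ xs → x ≢ y → R x y
AllPairs-lookup _   (_ ∷ _)   (here refl) (here refl) x≢x = contradiction refl x≢x
AllPairs-lookup _   (Rx ∷ _)  (here refl) (there y∈)  _   = All.lookup Rx y∈
AllPairs-lookup sym (Ry ∷ _)  (there x∈)  (here refl) _   = sym (All.lookup Ry x∈)
AllPairs-lookup sym (_ ∷ Rxs) (there x∈)  (there y∈)  x≢y = AllPairs-lookup sym Rxs x∈ y∈ x≢y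

Graph : ℕ → Set
Graph n = List (Fin n × Fin n)

variable
  G H : Graph n
  a b c x y : Fin n
  vs ws : List (Fin n)
  X Y Z X′ Y′ : Subset n

data Walk (G : Graph n) : Fin n → List (Fin n) → Fin n → Set where
  stop : Walk G a (a ∷ []) a
  _◅_  : (a , b) ∈ₗ G → Walk G b vs c → Walk G a (a ∷ vs) c

start∈ : Walk G a vs b → a ∈ₗ vs
start∈ stop    = here refl
start∈ (_ ◅ _) = here refl

end∈ : Walk G a vs b → b ∈ₗ vs
end∈ stop    = here refl
end∈ (_ ◅ w) = there (end∈ w)

Walk-mono : G ⊆ₗ H → Walk G a vs b → Walk H a vs b
Walk-mono G⊆H stop    = stop
Walk-mono G⊆H (e ◅ w) = G⊆H e ◅ Walk-mono G⊆H w

_++ʷ_ : Walk G a vs b → Walk G b (b ∷ ws) c → Walk G a (vs ++ ws) c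
stop    ++ʷ w′ = w′
(e ◅ w) ++ʷ w′ = e ◅ (w ++ʷ w′)

MeetsOnlyAt : Subset n → Fin n → List (Fin n) → Set
MeetsOnlyAt Z b vs = ∀ {u} → u ∈ₗ vs → u ∈ Z → u ≡ b

meetsOnlyAt-[_] : ∀ a → MeetsOnlyAt Z a (a ∷ [])
meetsOnlyAt-[ a ] (here refl) _ = refl

firstVisit : (Z : Subset n) → Walk G a vs b → b ∈ Z →
             ∃[ i ] ∃[ b′ ] Walk G a (take i vs) b′ × b′ ∈ Z × MeetsOnlyAt Z b′ (take i vs)
firstVisit {a = a} Z w b∈Z with a ∈? Z
firstVisit {a = a} Z stop    b∈Z | yes a∈Z = 1 , a , stop , a∈Z , meetsOnlyAt-[ a ]
firstVisit {a = a} Z (_ ◅ _) b∈Z | yes a∈Z = 1 , a , stop , a∈Z , meetsOnlyAt-[ a ]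
firstVisit         Z stop    b∈Z | no  a∉Z = contradiction b∈Z a∉Z
firstVisit         Z (e ◅ w) b∈Z | no  a∉Z with firstVisit Z w b∈Z
... | i , b′ , w′ , b′∈Z , meets = suc i , b′ , e ◅ w′ , b′∈Z , λ
  { (here refl) a∈Z → contradiction a∈Z a∉Z
  ; (there u∈)  u∈Z → meets u∈ u∈Z }

record LastVisit (G : Graph n) (Z : Subset n) (vs : List (Fin n)) (c : Fin n) : Set where
  field
    index    : ℕ
    vertex   : Fin n
    vertex∈Z : vertex ∈ Z
    vertex∈  : vertex ∈ₗ vs
    onward   : Walk G vertex (vertex ∷ drop (suc index) vs) c
    after∉Z  : All (_∉ Z) (drop (suc index) vs)

lastVisit : (Z : Subset n) → Walk G a vs c → All (_∉ Z) vs ⊎ LastVisit G Z vs c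
lastVisit {a = a} Z stop with a ∈? Z
... | yes a∈Z = inj₂ (record
  { index = 0 ; vertex = a ; vertex∈Z = a∈Z ; vertex∈ = here refl ; onward = stop ; after∉Z = [] })
... | no  a∉Z = inj₁ (a∉Z ∷ [])
lastVisit {a = a} Z (e ◅ w) with lastVisit Z w
... | inj₂ visit = inj₂ (record
  { index = suc index ; vertex = vertex ; vertex∈Z = vertex∈Z ; vertex∈ = there vertex∈
  ; onward = onward ; after∉Z = after∉Z })
  where open LastVisit visit
... | inj₁ rest∉Z with a ∈? Z
...   | yes a∈Z = inj₂ (record
  { index = 0 ; vertex = a ; vertex∈Z = a∈Z ; vertex∈ = here refl ; onward = e ◅ w ; after∉Z = rest∉Z })
...   | no  a∉Z = inj₁ (a∉Z ∷ rest∉Z)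

record Path (G : Graph n) (X Y : Subset n) : Set where
  constructor path
  field
    {start end} : Fin n
    {vertices}  : List (Fin n)
    walk        : Walk G start vertices end
    start∈X     : start ∈ X
    end∈Y       : end ∈ Y
    unique      : Unique vertices
open Path

disjoint⇒ends≢ : {p q : Path G X Y} → Disjoint (vertices p) (vertices q) → end p ≢ end q
disjoint⇒ends≢ {p = p} {q} p#q end≡ =
  p#q (end∈ (walk p) , subst (_∈ₗ vertices q) (sym end≡) (end∈ (walk q)))

upToFirstVisit : (p : Path G X Z) → ∃[ p′ ] vertices p′ ⊆ₗ vertices p × MeetsOnlyAt Z (end p′) (vertices p′)
upToFirstVisit p with firstVisit _ (walk p) (end∈Y p)
... | i , _ , w , e∈Z , meets =
  path w (start∈X p) e∈Z (Unique.take⁺ i (unique p)) , lookup (take-⊆ i _) , meets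

lastVisitOf : (q : Path G Z Y) → LastVisit G Z (vertices q) (end q)
lastVisitOf q with lastVisit _ (walk q)
... | inj₁ all∉Z = contradiction (start∈X q) (All.lookup all∉Z (start∈ (walk q)))
... | inj₂ visit = visit

record Linkage (G : Graph n) (X Y : Subset n) (k : ℕ) : Set where
  field
    paths    : List (Path G X Y)
    size     : length paths ≡ k
    disjoint : AllPairs (Disjoint on vertices) paths
open Linkage

map-Linkage : (f : Path G X Y → Path H X′ Y′) →
              (∀ {p q} → Disjoint (vertices p) (vertices q) → Disjoint (vertices (f p)) (vertices (f q))) →
              Linkage G X Y k → Linkage H X′ Y′ k
map-Linkage f f-disjoint L = record
  { paths    = map f (paths L)
  ; size     = trans (length-map f (paths L)) (size L)
  ; disjoint = AllPairs.map⁺ (AllPairs.map f-disjoint (disjoint L))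
  }

Linkage-mono : G ⊆ₗ H → Linkage G X Y k → Linkage H X Y k
Linkage-mono G⊆H = map-Linkage (λ p → path (Walk-mono G⊆H (walk p)) (start∈X p) (end∈Y p) (unique p)) id

record Separation (G : Graph n) (X Y : Subset n) (k : ℕ) : Set where
  field
    S A      : Subset n
    ∣S∣≤k    : ∣ S ∣ ≤ k
    S∩A=∅    : ∀ {u} → u ∈ S → u ∉ A
    X⊆A∪S    : ∀ {u} → u ∈ X → u ∈ A ⊎ u ∈ S
    A∩Y=∅    : ∀ {u} → u ∈ A → u ∉ Y
    A-closed : ∀ {u w} → (u , w) ∈ₗ G → u ∈ A → w ∈ A ⊎ w ∈ S

weaken : ∀ {k′} → k ≤ k′ → Separation G X Y k → Separation G X Y k′
weaken k≤k′ C = record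
  { S = S ; A = A ; ∣S∣≤k = ≤-trans ∣S∣≤k k≤k′
  ; S∩A=∅ = S∩A=∅ ; X⊆A∪S = X⊆A∪S ; A∩Y=∅ = A∩Y=∅ ; A-closed = A-closed }
  where open Separation C

Inside Outside : {G : Graph n} {X Y : Subset n} → Separation G X Y k → Fin n → Set
Inside  C u = u ∈ Separation.A C ⊎ u ∈ Separation.S C
Outside C u = u ∉ Separation.A C × u ∉ Separation.S C

module _ (C : Separation G X Y k) where
  open Separation C

  inside#outside : All (Inside C) vs → All (Outside C) ws → Disjoint vs ws
  inside#outside ins outs (u∈vs , u∈ws) =
    let u∉A , u∉S = All.lookup outs u∈ws in [ u∉A , u∉S ]′ (All.lookup ins u∈vs)

  walk-inside : Walk G a vs b → Inside C a → Unique vs → MeetsOnlyAt S b vs → All (Inside C) vs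
  walk-inside stop    a∈A∪S      _            _     = a∈A∪S ∷ []
  walk-inside (e ◅ w) (inj₁ a∈A) (_ ∷ unique) meets =
    inj₁ a∈A ∷ walk-inside w (A-closed e a∈A) unique (meets ∘ there)
  walk-inside (e ◅ w) (inj₂ a∈S) (a∉vs ∷ _)   meets =
    contradiction (meets (here refl) a∈S) (All.lookup a∉vs (end∈ w))

  walk-outside : Walk G a vs b → b ∈ Y → All (_∉ S) vs → All (_∉ A) vs
  walk-outside stop    b∈Y _            = (λ b∈A → A∩Y=∅ b∈A b∈Y) ∷ []
  walk-outside {vs = _ ∷ rest} (e ◅ w) b∈Y (_ ∷ rest∉S) =
    [ All.lookup rest∉A (start∈ w) , All.lookup rest∉S (start∈ w) ]′ ∘ A-closed e ∷ rest∉A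
    where
    rest∉A : All (_∉ A) rest
    rest∉A = walk-outside w b∈Y rest∉S

  onward-outside : Walk G a (a ∷ ws) b → b ∈ Y → All (_∉ S) ws → All (_∉ A) ws
  onward-outside stop    _   []   = []
  onward-outside (_ ◅ w) b∈Y ws∉S = walk-outside w b∈Y ws∉S

  extend : y ∈ A ⊎ y ∈ S → Separation ((x , y) ∷ G) X Y k
  extend y∈A∪S = record
    { S = S ; A = A ; ∣S∣≤k = ∣S∣≤k ; S∩A=∅ = S∩A=∅ ; X⊆A∪S = X⊆A∪S ; A∩Y=∅ = A∩Y=∅
    ; A-closed = λ { (here refl) _ → y∈A∪S ; (there e) → A-closed e }
    }

  separation-on-X-side : ∀ {x y} → Separation G X (S ∪ ⁅ x ⁆) k₁ → Separation ((x , y) ∷ G) X Y k₁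
  separation-on-X-side {x = x} {y = y} C₁ = record
    { S        = S₁
    ; A        = A₁ ∩ A
    ; ∣S∣≤k    = ∣S₁∣≤k₁
    ; S∩A=∅    = λ u∈S₁ → S₁∩A₁=∅ u∈S₁ ∘ proj₁ ∘ x∈p∩q⁻ A₁ A
    ; X⊆A∪S    = λ u∈X → [ inj₁ ∘ into-A₁∩A (X⊆A∪S u∈X) , inj₂ ]′ (X⊆A₁∪S₁ u∈X)
    ; A∩Y=∅    = A∩Y=∅ ∘ proj₂ ∘ x∈p∩q⁻ A₁ A
    ; A-closed = closed
    }
    where
    open Separation C₁ using ()
      renaming ( S to S₁; A to A₁; ∣S∣≤k to ∣S₁∣≤k₁; S∩A=∅ to S₁∩A₁=∅; X⊆A∪S to X⊆A₁∪S₁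
               ; A∩Y=∅ to A₁∩S∪⁅x⁆=∅; A-closed to A₁-closed )
    into-A₁∩A : ∀ {u} → Inside C u → u ∈ A₁ → u ∈ A₁ ∩ A
    into-A₁∩A (inj₁ u∈A) u∈A₁ = x∈p∩q⁺ (u∈A₁ , u∈A)
    into-A₁∩A (inj₂ u∈S) u∈A₁ = contradiction (x∈p∪q⁺ (inj₁ u∈S)) (A₁∩S∪⁅x⁆=∅ u∈A₁)
    closed : ∀ {u w} → (u , w) ∈ₗ (x , y) ∷ G → u ∈ A₁ ∩ A → w ∈ A₁ ∩ A ⊎ w ∈ S₁
    closed (here refl) u∈A₁∩A =
      contradiction (x∈p∪q⁺ (inj₂ (x∈⁅x⁆ x))) (A₁∩S∪⁅x⁆=∅ (proj₁ (x∈p∩q⁻ A₁ A u∈A₁∩A)))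
    closed (there e)   u∈A₁∩A =
      let u∈A₁ , u∈A = x∈p∩q⁻ A₁ A u∈A₁∩A
      in [ inj₁ ∘ into-A₁∩A (A-closed e u∈A) , inj₂ ]′ (A₁-closed e u∈A₁)

  separation-on-Y-side : ∀ {x y} → Separation G (S ∪ ⁅ y ⁆) Y k₂ → Separation ((x , y) ∷ G) X Y k₂
  separation-on-Y-side {x = x} {y = y} C₂ = record
    { S        = S₂
    ; A        = (A ∪ A₂) ∩ ∁ S₂
    ; ∣S∣≤k    = ∣S₂∣≤k₂
    ; S∩A=∅    = λ u∈S₂ u∈A′ → proj₂ (x∈p∩∁q⁻ (A ∪ A₂) S₂ u∈A′) u∈S₂
    ; X⊆A∪S    = settle ∘ from-C ∘ X⊆A∪S
    ; A∩Y=∅    = [ A∩Y=∅ , A₂∩Y=∅ ]′ ∘ x∈p∪q⁻ A A₂ ∘ proj₁ ∘ x∈p∩∁q⁻ (A ∪ A₂) S₂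
    ; A-closed = closed
    }
    where
    open Separation C₂ using ()
      renaming ( S to S₂; A to A₂; ∣S∣≤k to ∣S₂∣≤k₂; X⊆A∪S to S∪⁅y⁆⊆A₂∪S₂
               ; A∩Y=∅ to A₂∩Y=∅; A-closed to A₂-closed )
    settle : ∀ {w} → w ∈ A ∪ A₂ ⊎ w ∈ S₂ → w ∈ (A ∪ A₂) ∩ ∁ S₂ ⊎ w ∈ S₂
    settle     (inj₂ w∈S₂)   = inj₂ w∈S₂
    settle {w} (inj₁ w∈A∪A₂) with w ∈? S₂
    ... | yes w∈S₂ = inj₂ w∈S₂
    ... | no  w∉S₂ = inj₁ (x∈p∩∁q⁺ w∈A∪A₂ w∉S₂)
    from-C₂ : ∀ {w} → w ∈ A₂ ⊎ w ∈ S₂ → w ∈ A ∪ A₂ ⊎ w ∈ S₂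
    from-C₂ = [ inj₁ ∘ x∈p∪q⁺ ∘ inj₂ , inj₂ ]′
    from-C : ∀ {w} → Inside C w → w ∈ A ∪ A₂ ⊎ w ∈ S₂
    from-C = [ inj₁ ∘ x∈p∪q⁺ ∘ inj₁ , from-C₂ ∘ S∪⁅y⁆⊆A₂∪S₂ ∘ x∈p∪q⁺ ∘ inj₁ ]′
    closed : ∀ {u w} → (u , w) ∈ₗ (x , y) ∷ G → u ∈ (A ∪ A₂) ∩ ∁ S₂ → w ∈ (A ∪ A₂) ∩ ∁ S₂ ⊎ w ∈ S₂
    closed (here refl) _    = settle (from-C₂ (S∪⁅y⁆⊆A₂∪S₂ (x∈p∪q⁺ (inj₂ (x∈⁅x⁆ y)))))
    closed (there e)   u∈A′ = settle ([ from-C ∘ A-closed e , from-C₂ ∘ A₂-closed e ]′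
                                        (x∈p∪q⁻ A A₂ (proj₁ (x∈p∩∁q⁻ (A ∪ A₂) S₂ u∈A′))))

  separation-with-tail : ∀ {x y} → Separation ((x , y) ∷ G) X Y (suc k)
  separation-with-tail {x = x} = record
    { S        = S ∪ ⁅ x ⁆
    ; A        = A ∩ ∁ ⁅ x ⁆
    ; ∣S∣≤k    = ≤-trans (∣p∪⁅x⁆∣≤1+∣p∣ S x) (s≤s ∣S∣≤k)
    ; S∩A=∅    = λ u∈S∪⁅x⁆ u∈A′ →
                   let u∈A , u∉⁅x⁆ = x∈p∩∁q⁻ A ⁅ x ⁆ u∈A′
                   in [ (λ u∈S → S∩A=∅ u∈S u∈A) , u∉⁅x⁆ ]′ (x∈p∪q⁻ S ⁅ x ⁆ u∈S∪⁅x⁆)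
    ; X⊆A∪S    = split-off ∘ X⊆A∪S
    ; A∩Y=∅    = A∩Y=∅ ∘ proj₁ ∘ x∈p∩∁q⁻ A ⁅ x ⁆
    ; A-closed = λ
        { (here refl) u∈A′ → contradiction (x∈⁅x⁆ x) (proj₂ (x∈p∩∁q⁻ A ⁅ x ⁆ u∈A′))
        ; (there e)   u∈A′ → split-off (A-closed e (proj₁ (x∈p∩∁q⁻ A ⁅ x ⁆ u∈A′))) }
    }
    where
    split-off : ∀ {u} → Inside C u → u ∈ A ∩ ∁ ⁅ x ⁆ ⊎ u ∈ S ∪ ⁅ x ⁆
    split-off     (inj₂ u∈S) = inj₂ (x∈p∪q⁺ (inj₁ u∈S))
    split-off {u} (inj₁ u∈A) with u ∈? ⁅ x ⁆
    ... | yes u∈⁅x⁆ = inj₂ (x∈p∪q⁺ (inj₂ u∈⁅x⁆))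
    ... | no  u∉⁅x⁆ = inj₁ (x∈p∩∁q⁺ u∈A u∉⁅x⁆)

module Crossing {x y : Fin n} (C : Separation G X Y k) (y∉A : y ∉ Separation.A C) (y∉S : y ∉ Separation.S C)
                (L₂ : Linkage G (Separation.S C ∪ ⁅ y ⁆) Y k₂) (k<k₂ : k < k₂) where

  open Separation C

  front : Path G X (S ∪ ⁅ x ⁆) → Path G X (S ∪ ⁅ x ⁆)
  front = proj₁ ∘ upToFirstVisit

  front⊆ : (p : Path G X (S ∪ ⁅ x ⁆)) → vertices (front p) ⊆ₗ vertices p
  front⊆ = proj₁ ∘ proj₂ ∘ upToFirstVisit

  front-inside : (p : Path G X (S ∪ ⁅ x ⁆)) → All (Inside C) (vertices (front p))
  front-inside p = walk-inside C (walk (front p)) (X⊆A∪S (start∈X (front p))) (unique (front p))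
                     (λ u∈ u∈S → proj₂ (proj₂ (upToFirstVisit p)) u∈ (x∈p∪q⁺ (inj₁ u∈S)))

  exit : Path G (S ∪ ⁅ y ⁆) Y → Fin n
  exit = LastVisit.vertex ∘ lastVisitOf

  module _ (q : Path G (S ∪ ⁅ y ⁆) Y) where
    open LastVisit (lastVisitOf q)

    after : List (Fin n)
    after = drop (suc index) (vertices q)

    after⊆ : after ⊆ₗ vertices q
    after⊆ = lookup (drop-⊆ (suc index) (vertices q))

    after-unique : Unique after
    after-unique = Unique.drop⁺ (suc index) (unique q)

    after∉S : All (_∉ S) after
    after∉S = All.map (λ u∉S∪⁅y⁆ → u∉S∪⁅y⁆ ∘ x∈p∪q⁺ ∘ inj₁) after∉Z

    after-outside : All (Outside C) after
    after-outside = All.zip (onward-outside C onward (end∈Y q) after∉S , after∉S)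

    y∉after : All (y ≢_) after
    y∉after = All.map (λ u∉S∪⁅y⁆ y≡u → u∉S∪⁅y⁆ (subst (_∈ S ∪ ⁅ y ⁆) y≡u y∈S∪⁅y⁆)) after∉Z
      where
      y∈S∪⁅y⁆ : y ∈ S ∪ ⁅ y ⁆
      y∈S∪⁅y⁆ = x∈p∪q⁺ (inj₂ (x∈⁅x⁆ y))

    onward-from : ∀ {v} → exit q ≡ v → Walk G v (v ∷ after) (end q)
    onward-from refl = onward

    exit∈ : ∀ {v} → exit q ≡ v → v ∈ₗ vertices q
    exit∈ refl = vertex∈

  exits : List (Fin n)
  exits = map exit (paths L₂)

  exits-unique : Unique exits
  exits-unique = AllPairs.map⁺ (AllPairs.map (λ {q} {q′} → exits≢ {q} {q′}) (disjoint L₂))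
    where
    exits≢ : {q q′ : Path G (S ∪ ⁅ y ⁆) Y} → Disjoint (vertices q) (vertices q′) → exit q ≢ exit q′
    exits≢ {q} {q′} q#q′ exit≡ = q#q′ (exit∈ q refl , exit∈ q′ (sym exit≡))

  exits⊆S∪⁅y⁆ : All (_∈ S ∪ ⁅ y ⁆) exits
  exits⊆S∪⁅y⁆ = All.map⁺ (All.universal (LastVisit.vertex∈Z ∘ lastVisitOf) (paths L₂))

  ∣S∪⁅y⁆∣≤length-exits : ∣ S ∪ ⁅ y ⁆ ∣ ≤ length exits
  ∣S∪⁅y⁆∣≤length-exits = begin
    ∣ S ∪ ⁅ y ⁆ ∣     ≤⟨ ∣p∪⁅x⁆∣≤1+∣p∣ S y ⟩
    suc ∣ S ∣         ≤⟨ s≤s ∣S∣≤k ⟩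
    suc k             ≤⟨ k<k₂ ⟩
    k₂                ≡⟨ sym (size L₂) ⟩
    length (paths L₂) ≡⟨ sym (length-map exit (paths L₂)) ⟩
    length exits      ∎
    where open ≤-Reasoning

  cover : ∀ {z} → z ∈ S ∪ ⁅ y ⁆ → ∃[ q ] q ∈ₗ paths L₂ × exit q ≡ z
  cover z∈ =
    let q , q∈ , z≡ = ∈-map⁻ exit (∣p∣≤length⇒∈ exits-unique exits⊆S∪⁅y⁆ ∣S∪⁅y⁆∣≤length-exits z∈)
    in q , q∈ , sym z≡

  data Junction (e : Fin n) : Fin n → Set where
    at-S      : e ∈ S → Junction e e
    across-xy : e ≡ x → Junction e y

  junction-injective : ∀ {e₁ e₂ z} → Junction e₁ z → Junction e₂ z → e₁ ≡ e₂
  junction-injective (at-S _)         (at-S _)         = refl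
  junction-injective (at-S y∈S)       (across-xy _)    = contradiction y∈S y∉S
  junction-injective (across-xy _)    (at-S y∈S)       = contradiction y∈S y∉S
  junction-injective (across-xy e₁≡x) (across-xy e₂≡x) = trans e₁≡x (sym e₂≡x)

  record Continuation (e : Fin n) : Set where
    field
      source       : Path G (S ∪ ⁅ y ⁆) Y
      source∈      : source ∈ₗ paths L₂
      junction     : Junction e (exit source)
      tail         : List (Fin n)
      tail⊆        : tail ⊆ₗ vertices source
      onward       : Walk ((x , y) ∷ G) e (e ∷ tail) (end source)
      tail-outside : All (Outside C) tail
      tail-unique  : Unique tail
  open Continuation

  continue : ∀ {e} → e ∈ S ∪ ⁅ x ⁆ → Continuation e
  continue {e} e∈ with e ∈? S
  ... | yes e∈S = let q , q∈ , exit≡e = cover (x∈p∪q⁺ (inj₁ e∈S)) in record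
    { source = q ; source∈ = q∈ ; junction = subst (Junction e) (sym exit≡e) (at-S e∈S)
    ; tail = after q ; tail⊆ = after⊆ q ; onward = Walk-mono there (onward-from q exit≡e)
    ; tail-outside = after-outside q ; tail-unique = after-unique q
    }
  ... | no  e∉S = let q , q∈ , exit≡y = cover (x∈p∪q⁺ (inj₂ (x∈⁅x⁆ y))) in record
    { source = q ; source∈ = q∈ ; junction = subst (Junction e) (sym exit≡y) (across-xy e≡x)
    ; tail = y ∷ after q ; tail⊆ = λ { (here refl) → exit∈ q exit≡y ; (there u∈) → after⊆ q u∈ }
    ; onward = here (cong (_, y) e≡x) ◅ Walk-mono there (onward-from q exit≡y)
    ; tail-outside = (y∉A , y∉S) ∷ after-outside q ; tail-unique = y∉after q ∷ after-unique q
    }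
    where
    e≡x : e ≡ x
    e≡x = [ (λ e∈S → contradiction e∈S e∉S) , x∈⁅y⁆⇒x≡y x ]′ (x∈p∪q⁻ S ⁅ x ⁆ e∈)

  continuations-disjoint : ∀ {e₁ e₂} → e₁ ≢ e₂ → (c₁ : Continuation e₁) (c₂ : Continuation e₂) →
                           Disjoint (tail c₁) (tail c₂)
  continuations-disjoint e₁≢e₂ c₁ c₂ = Disjoint-resp-⊇ (tail⊆ c₁) (tail⊆ c₂)
    (AllPairs-lookup Disjoint-sym (disjoint L₂) (source∈ c₁) (source∈ c₂) sources≢)
    where
    sources≢ : source c₁ ≢ source c₂
    sources≢ source≡ =
      e₁≢e₂ (junction-injective (junction c₁) (subst (Junction _ ∘ exit) (sym source≡) (junction c₂)))

  continuation : (p : Path G X (S ∪ ⁅ x ⁆)) → Continuation (end (front p))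
  continuation p = continue (end∈Y (front p))

  join : Path G X (S ∪ ⁅ x ⁆) → Path ((x , y) ∷ G) X Y
  join p = path (Walk-mono there (walk (front p)) ++ʷ onward (continuation p))
                (start∈X (front p)) (end∈Y (source (continuation p)))
                (Unique.++⁺ (unique (front p)) (tail-unique (continuation p))
                            (inside#outside C (front-inside p) (tail-outside (continuation p))))

  join-disjoint : {p₁ p₂ : Path G X (S ∪ ⁅ x ⁆)} →
                  Disjoint (vertices p₁) (vertices p₂) → Disjoint (vertices (join p₁)) (vertices (join p₂))
  join-disjoint {p₁} {p₂} p₁#p₂ (u∈₁ , u∈₂)
    with ∈-++⁻ (vertices (front p₁)) u∈₁ | ∈-++⁻ (vertices (front p₂)) u∈₂
  ... | inj₁ u∈f₁ | inj₁ u∈f₂ = p₁#p₂ (front⊆ p₁ u∈f₁ , front⊆ p₂ u∈f₂)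
  ... | inj₁ u∈f₁ | inj₂ u∈t₂ =
    inside#outside C (front-inside p₁) (tail-outside (continuation p₂)) (u∈f₁ , u∈t₂)
  ... | inj₂ u∈t₁ | inj₁ u∈f₂ =
    inside#outside C (front-inside p₂) (tail-outside (continuation p₁)) (u∈f₂ , u∈t₁)
  ... | inj₂ u∈t₁ | inj₂ u∈t₂ =
    continuations-disjoint ends≢ (continuation p₁) (continuation p₂) (u∈t₁ , u∈t₂)
    where
    ends≢ : end (front p₁) ≢ end (front p₂)
    ends≢ = disjoint⇒ends≢ {p = front p₁} {q = front p₂} (Disjoint-resp-⊇ (front⊆ p₁) (front⊆ p₂) p₁#p₂)

  joined-linkage : Linkage G X (S ∪ ⁅ x ⁆) k₁ → Linkage ((x , y) ∷ G) X Y k₁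
  joined-linkage = map-Linkage join (λ {p₁} {p₂} → join-disjoint {p₁} {p₂})

empty-graph-linkage : (X Y : Subset n) → Linkage [] X Y ∣ X ∩ Y ∣
empty-graph-linkage X Y with enumerate (X ∩ Y)
... | us , distinct , length≡ = record
  { paths    = map trivial us
  ; size     = trans (length-map trivial us) length≡
  ; disjoint = AllPairs.map⁺ (AllPairs.map (λ u≢w → λ { (here refl , here refl) → u≢w refl }) distinct)
  }
  where
  trivial : ∃ (_∈ X ∩ Y) → Path [] X Y
  trivial (u , u∈X∩Y) = let u∈X , u∈Y = x∈p∩q⁻ X Y u∈X∩Y in path stop u∈X u∈Y ([] ∷ [])

empty-graph-separation : (X Y : Subset n) → Separation [] X Y ∣ X ∩ Y ∣
empty-graph-separation X Y = record
  { S        = X ∩ Y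
  ; A        = X ∩ ∁ Y
  ; ∣S∣≤k    = ≤-refl
  ; S∩A=∅    = λ u∈X∩Y u∈A → proj₂ (x∈p∩∁q⁻ X Y u∈A) (proj₂ (x∈p∩q⁻ X Y u∈X∩Y))
  ; X⊆A∪S    = side
  ; A∩Y=∅    = proj₂ ∘ x∈p∩∁q⁻ X Y
  ; A-closed = λ ()
  }
  where
  side : ∀ {u} → u ∈ X → u ∈ X ∩ ∁ Y ⊎ u ∈ X ∩ Y
  side {u} u∈X with u ∈? Y
  ... | yes u∈Y = inj₂ (x∈p∩q⁺ (u∈X , u∈Y))
  ... | no  u∉Y = inj₁ (x∈p∩∁q⁺ u∈X u∉Y)

menger : (G : Graph n) (X Y : Subset n) → ∃[ k ] Linkage G X Y k × Separation G X Y k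
menger []            X Y = ∣ X ∩ Y ∣ , empty-graph-linkage X Y , empty-graph-separation X Y
menger ((x , y) ∷ G) X Y with menger G X Y
... | k , L , C with y ∈? Separation.A C | y ∈? Separation.S C
...   | yes y∈A | _       = k , Linkage-mono there L , extend C (inj₁ y∈A)
...   | no  _   | yes y∈S = k , Linkage-mono there L , extend C (inj₂ y∈S)
...   | no  y∉A | no  y∉S
  with menger G X (Separation.S C ∪ ⁅ x ⁆) | menger G (Separation.S C ∪ ⁅ y ⁆) Y
...     | k₁ , L₁ , C₁ | k₂ , L₂ , C₂ with k₁ ≤? k | k₂ ≤? k
...       | yes k₁≤k | _        = k , Linkage-mono there L , weaken k₁≤k (separation-on-X-side C C₁)
...       | no  _    | yes k₂≤k = k , Linkage-mono there L , weaken k₂≤k (separation-on-Y-side C C₂)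
...       | no  k₁≰k | no  k₂≰k =
  k₁ , Crossing.joined-linkage C y∉A y∉S L₂ (≰⇒> k₂≰k) L₁ , weaken (≰⇒> k₁≰k) (separation-with-tail C)

outNeighbours inNeighbours : Digraph n → Fin n → Subset n
outNeighbours D v = tabulate (adj D v)
inNeighbours  D v = tabulate (λ u → adj D u v)

∈-tabulate⁺ : {f : Fin n → Bool} → f a ≡ true → a ∈ tabulate f
∈-tabulate⁺ {a = a} {f} fa = lookup⇒[]= a (tabulate f) (trans (lookup∘tabulate f a) fa)

∈-tabulate⁻ : {f : Fin n → Bool} → a ∈ tabulate f → f a ≡ true
∈-tabulate⁻ {a = a} {f} a∈ = trans (sym (lookup∘tabulate f a)) ([]=⇒lookup a∈)

Arc⇒≢ : (D : Digraph n) → Arc D a b → a ≢ b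
Arc⇒≢ {a = a} D arc refl = contradiction (trans (sym arc) (loopless D a)) λ ()

ArcNotInto : Digraph n → Fin n → Fin n × Fin n → Set
ArcNotInto D v (u , w) = Arc D u w × w ≢ v

arcNotInto? : (D : Digraph n) (v : Fin n) (e : Fin n × Fin n) → Dec (ArcNotInto D v e)
arcNotInto? D v (u , w) = (adj D u w Bool.≟ true) ×-dec ¬? (w ≟ v)

-- The arcs out of v may stay: no path starting in N⁺(v) can reach v.
arcsNotInto : Digraph n → Fin n → Graph n
arcsNotInto {n} D v = filter (arcNotInto? D v) (cartesianProduct (allFin n) (allFin n))

∈-arcsNotInto⁻ : {D : Digraph n} {v : Fin n} → (a , b) ∈ₗ arcsNotInto D v → Arc D a b × b ≢ v
∈-arcsNotInto⁻ {n} {D = D} {v} =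
  proj₂ ∘ ∈-filter⁻ (arcNotInto? D v) {xs = cartesianProduct (allFin n) (allFin n)}

∈-arcsNotInto⁺ : {D : Digraph n} {v : Fin n} → Arc D a b → b ≢ v → (a , b) ∈ₗ arcsNotInto D v
∈-arcsNotInto⁺ {a = a} {b} {D} {v} arc b≢v =
  ∈-filter⁺ (arcNotInto? D v) (∈-cartesianProduct⁺ (∈-allFin a) (∈-allFin b)) (arc , b≢v)

module _ (D : Digraph n) (v : Fin n) where

  Linkage⁺⁻ : ℕ → Set
  Linkage⁺⁻ = Linkage (arcsNotInto D v) (outNeighbours D v) (inNeighbours D v)

  Separation⁺⁻ : ℕ → Set
  Separation⁺⁻ = Separation (arcsNotInto D v) (outNeighbours D v) (inNeighbours D v)

  walk⇒ArcWalk : Walk (arcsNotInto D v) a vs b → Arc D x a → Arc D b y → ArcWalk D x vs y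
  walk⇒ArcWalk stop    xa by = step xa (last by)
  walk⇒ArcWalk (e ◅ w) xa by = step xa (walk⇒ArcWalk w (proj₁ (∈-arcsNotInto⁻ {D = D} {v} e)) by)

  walk-avoids : Walk (arcsNotInto D v) a vs b → v ≢ a → All (v ≢_) vs
  walk-avoids stop    v≢a = v≢a ∷ []
  walk-avoids (e ◅ w) v≢a = v≢a ∷ walk-avoids w (≢-sym (proj₂ (∈-arcsNotInto⁻ {D = D} {v} e)))

  path⇒cycle : (p : Path (arcsNotInto D v) (outNeighbours D v) (inNeighbours D v)) →
               CycleThrough D v (vertices p)
  path⇒cycle p =
    1≤length (walk p) , walk-avoids (walk p) (Arc⇒≢ D v→start) ∷ unique p ,
    walk⇒ArcWalk (walk p) v→start (∈-tabulate⁻ (end∈Y p))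
    where
    v→start : Arc D v (start p)
    v→start = ∈-tabulate⁻ (start∈X p)
    1≤length : Walk G a vs b → 1 ≤ length vs
    1≤length stop    = s≤s z≤n
    1≤length (_ ◅ _) = s≤s z≤n

  linkage⇒cycles : (L : Linkage⁺⁻ k) → OpenlyDisjointCycles D v (map vertices (paths L))
  linkage⇒cycles L = All.map⁺ (All.universal path⇒cycle (paths L)) , AllPairs.map⁺ (disjoint L)

  linkage-size≤c : ∀ {c} → IsC D c → Linkage⁺⁻ k → k ≤ c
  linkage-size≤c {c = c} (_ , maximal) L =
    subst (_≤ c) (trans (length-map vertices (paths L)) (size L)) (maximal v _ (linkage⇒cycles L))

  module _ {c : ℕ} (C : Separation⁺⁻ c) where
    open Separation C

    A⁺ B⁺ : Subset n
    A⁺ = (A ∪ ⁅ v ⁆) ∩ ∁ S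
    B⁺ = ∁ (A ∪ ⁅ v ⁆) ∩ ∁ S

    B⁺⁻ : ∀ {u} → u ∈ B⁺ → u ∉ A ∪ ⁅ v ⁆ × u ∉ S
    B⁺⁻ u∈B⁺ = let u∈∁ , u∉S = x∈p∩∁q⁻ (∁ (A ∪ ⁅ v ⁆)) S u∈B⁺ in x∈∁p⇒x∉p u∈∁ , u∉S

    trichotomy : ∀ u → u ∈ S ⊎ u ∈ A⁺ ⊎ u ∈ B⁺
    trichotomy u with u ∈? S | u ∈? A ∪ ⁅ v ⁆
    ... | yes u∈S | _             = inj₁ u∈S
    ... | no  u∉S | yes u∈A∪⁅v⁆ = inj₂ (inj₁ (x∈p∩∁q⁺ u∈A∪⁅v⁆ u∉S))
    ... | no  u∉S | no  u∉A∪⁅v⁆ = inj₂ (inj₂ (x∈p∩∁q⁺ (x∉p⇒x∈∁p u∉A∪⁅v⁆) u∉S))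

    S-exclusive : ∀ u → u ∈ S → u ∉ A⁺ × u ∉ B⁺
    S-exclusive u u∈S = (λ u∈A⁺ → proj₂ (x∈p∩∁q⁻ (A ∪ ⁅ v ⁆) S u∈A⁺) u∈S) , (λ u∈B⁺ → proj₂ (B⁺⁻ u∈B⁺) u∈S)

    A⁺-exclusive : ∀ u → u ∈ A⁺ → u ∉ B⁺
    A⁺-exclusive u u∈A⁺ u∈B⁺ = proj₁ (B⁺⁻ u∈B⁺) (proj₁ (x∈p∩∁q⁻ (A ∪ ⁅ v ⁆) S u∈A⁺))

    out-neighbours⊆A⁺∪S : ∀ u → Arc D v u → u ∈ A⁺ ⊎ u ∈ S
    out-neighbours⊆A⁺∪S u arc with u ∈? S | X⊆A∪S (∈-tabulate⁺ arc)
    ... | yes u∈S | _        = inj₂ u∈S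
    ... | no  u∉S | inj₁ u∈A = inj₁ (x∈p∩∁q⁺ (x∈p∪q⁺ (inj₁ u∈A)) u∉S)
    ... | no  u∉S | inj₂ u∈S = contradiction u∈S u∉S

    in-neighbours⊆B⁺∪S : ∀ u → Arc D u v → u ∈ B⁺ ⊎ u ∈ S
    in-neighbours⊆B⁺∪S u arc with u ∈? S
    ... | yes u∈S = inj₂ u∈S
    ... | no  u∉S = inj₁ (x∈p∩∁q⁺ (x∉p⇒x∈∁p u∉A∪⁅v⁆) u∉S)
      where
      u∉A∪⁅v⁆ : u ∉ A ∪ ⁅ v ⁆
      u∉A∪⁅v⁆ = [ (λ u∈A → A∩Y=∅ u∈A (∈-tabulate⁺ arc)) , Arc⇒≢ D arc ∘ x∈⁅y⁆⇒x≡y v ]′ ∘ x∈p∪q⁻ A ⁅ v ⁆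

    no-arc-A⁺→B⁺ : ∀ u w → u ∈ A⁺ → w ∈ B⁺ → ¬ Arc D u w
    no-arc-A⁺→B⁺ u w u∈A⁺ w∈B⁺ arc =
      [ w∉A , proj₂ (B⁺⁻ w∈B⁺) ]′ (w∈A∪S (x∈p∪q⁻ A ⁅ v ⁆ (proj₁ (x∈p∩∁q⁻ (A ∪ ⁅ v ⁆) S u∈A⁺))))
      where
      w∉A∪⁅v⁆ : w ∉ A ∪ ⁅ v ⁆
      w∉A∪⁅v⁆ = proj₁ (B⁺⁻ w∈B⁺)
      w∉A : w ∉ A
      w∉A = w∉A∪⁅v⁆ ∘ x∈p∪q⁺ ∘ inj₁
      w≢v : w ≢ v
      w≢v w≡v = w∉A∪⁅v⁆ (x∈p∪q⁺ (inj₂ (subst (_∈ ⁅ v ⁆) (sym w≡v) (x∈⁅x⁆ v))))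
      w∈A∪S : u ∈ A ⊎ u ∈ ⁅ v ⁆ → w ∈ A ⊎ w ∈ S
      w∈A∪S (inj₁ u∈A)   = A-closed (∈-arcsNotInto⁺ {D = D} arc w≢v) u∈A
      w∈A∪S (inj₂ u∈⁅v⁆) = X⊆A∪S (∈-tabulate⁺ (subst (λ u → Arc D u w) (x∈⁅y⁆⇒x≡y v u∈⁅v⁆) arc))

    separation⇒split :
      ∃[ S ] ∃[ A ] ∃[ B ]
        ( ∣ S ∣ ≤ c
        × (∀ x → x ∈ S ⊎ x ∈ A ⊎ x ∈ B)
        × (∀ x → x ∈ S → x ∉ A × x ∉ B)
        × (∀ x → x ∈ A → x ∉ B)
        × (∀ x → Arc D v x → x ∈ A ⊎ x ∈ S)
        × (∀ x → Arc D x v → x ∈ B ⊎ x ∈ S)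
        × (∀ x y → x ∈ A → y ∈ B → ¬ Arc D x y) )
    separation⇒split =
      S , A⁺ , B⁺ , ∣S∣≤k , trichotomy , S-exclusive , A⁺-exclusive ,
      out-neighbours⊆A⁺∪S , in-neighbours⊆B⁺∪S , no-arc-A⁺→B⁺

corollary2p2 : ∀ {n} (D : Digraph n) (c : ℕ) → IsC D c → (v : Fin n) →
    ∃[ S ] ∃[ A ] ∃[ B ]
      ( ∣ S ∣ ≤ c
      × (∀ x → x ∈ S ⊎ x ∈ A ⊎ x ∈ B)
      × (∀ x → x ∈ S → x ∉ A × x ∉ B)
      × (∀ x → x ∈ A → x ∉ B)
      × (∀ x → Arc D v x → x ∈ A ⊎ x ∈ S)
      × (∀ x → Arc D x v → x ∈ B ⊎ x ∈ S)
      × (∀ x y → x ∈ A → y ∈ B → ¬ Arc D x y) )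
corollary2p2 D c isC v with menger (arcsNotInto D v) (outNeighbours D v) (inNeighbours D v)
... | k , L , C = separation⇒split D v (weaken (linkage-size≤c D v isC L) C)
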